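{- Let $g$ be a positive integer and let $p$ be a prime number with $p\equiv 1\pmod g$. Then there exists a subset $A\subseteq\mathbb{Z}_{(p^2-p)/g}$ with $|A|=p-1$ such that $A\in B_2[g]\big(\mathbb{Z}_{(p^2-p)/g}\big)$.
   Context: $\mathbb{Z}_N$ denotes the additive cyclic group of integers modulo $N$. For an additive abelian group $G$, a subset $A\subseteq G$ and positive integers $h\ge 2$, $g$, we write $A\in B_h[g](G)$ if every $b\in G$ has at most $g$ distinct representations $b=a_1+\cdots+a_h$ with $a_1,\dots,a_h\in A$, counted up to reordering of the summands. -}

module Defs where

open import Data.Nat using (ℕ; zero; suc; _+_; _≤?_)
open import Data.Nat.DivMod using (_%_; m%n<n)
open import Data.Fin using (Fin; toℕ; fromℕ<; _≟_)
open import Data.Fin.Subset using (Subset; _∈_)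
open import Data.Fin.Subset.Properties using (_∈?_)
open import Data.List using (List; length; filter; allFin; cartesianProduct)
open import Data.Product using (_×_; _,_; proj₁; proj₂)
open import Relation.Nullary using (Dec)
open import Relation.Nullary.Decidable using (_×-dec_)

_+ₘ_ : {N : ℕ} → Fin N → Fin N → Fin N
_+ₘ_ {suc n} a b = fromℕ< (m%n<n (toℕ a + toℕ b) (suc n))

-- number of representations b = a₁ + a₂ with a₁, a₂ ∈ A, counted up to
-- reordering: we count pairs (a₁ , a₂) with toℕ a₁ ≤ toℕ a₂ (a canonical
-- representative of each unordered pair / multiset {a₁ , a₂}).
reps2 : {N : ℕ} → Subset N → Fin N → ℕ
reps2 {N} A b = length (filter ok (cartesianProduct (allFin N) (allFin N)))
  where
  ok : (x : Fin N × Fin N) → Dec _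
  ok (a₁ , a₂) = (toℕ a₁ ≤? toℕ a₂) ×-dec ((a₁ ∈? A) ×-dec ((a₂ ∈? A) ×-dec ((a₁ +ₘ a₂) ≟ b)))

B2 : (N : ℕ) → ℕ → Subset N → Set
B2 N g A = (b : Fin N) → reps2 A b Data.Nat.≤ g

-- Write p − 1 = m g, N = p m, and let θ be a primitive root modulo p. The set
-- A = { m θⁱ + p i mod N : 0 ≤ i < p − 1 } has p − 1 elements. Since gcd(p, m) = 1,
-- a sum of two elements of A determines θⁱ + θʲ modulo p (reduce modulo p) and
-- i + j modulo m (reduce modulo m). Of i + j modulo p − 1 = m g it leaves open only
-- which of the g blocks [k m, (k + 1) m) it lies in; once the block is fixed,
-- i + j modulo p − 1 and hence θⁱ θʲ = θ^(i+j) modulo p are known, and two residues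
-- with known sum and product modulo p are determined up to order. So every b has
-- at most g representations. The primitive root comes from Fermat's little theorem
-- and Lagrange's bound on the number of roots of a polynomial modulo p, by
-- multiplying together elements whose orders are the prime powers dividing p − 1.

module Submission where

open import Data.Nat
open import Data.Nat.Properties
open import Data.Nat.DivMod
open import Data.Nat.Divisibility
open import Data.Nat.Coprimality using (Coprime; coprime-divisor; coprime-Bézout)
import Data.Nat.Coprimality as Coprimality
open import Data.Nat.GCD using (module Bézout)
open import Data.Nat.Primality
open import Data.Nat.Primality.Factorisation using (factorise)
open import Data.Nat.Induction using (<-rec)
open import Data.Nat.ListAction using (product)
open import Data.Nat.ListAction.Properties using (product-↭)
open import Data.Nat.Tactic.RingSolver using (solve-∀)
import Data.Integer as ℤ
import Data.Integer.Properties as ℤ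
open import Data.Integer using (_⊖_)
open import Data.Integer.Tactic.RingSolver using () renaming (solve-∀ to ℤ-solve-∀)
open import Data.Fin as Fin using (Fin; toℕ; fromℕ<; fromℕ)
open import Data.Fin.Properties using (toℕ<n; toℕ-injective; toℕ-fromℕ<; toℕ-fromℕ; toℕ-inject; ¬∀⟶∃¬; ¬∀⟶∃¬-smallest)
open import Data.Fin.Subset using (Subset; inside; outside; ⁅_⁆; _∪_; ⋃; ∣_∣; _∉_) renaming (_∈_ to _∈ₛ_)
open import Data.Fin.Subset.Properties using (∪-identityˡ; ∉⊥; ∣⊥∣≡0; x∈⁅y⁆⇒x≡y; x∈p∪q⁻; ∣p∣≤n; _∈?_)
open import Data.Vec as Vec using (_∷_)
open import Data.List using (List; []; _∷_; length; map; replicate; tabulate; allFin; cartesianProduct)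
open import Data.List.Properties using (length-replicate; length-tabulate; map-tabulate)
open import Data.List.Membership.Propositional using (_∈_)
open import Data.List.Membership.Propositional.Properties using (∈-tabulate⁺; ∈-tabulate⁻; ∈-map⁺; ∈-map⁻)
open import Data.List.Membership.Propositional.Properties.WithK using (unique∧set⇒bag)
open import Data.List.Relation.Binary.BagAndSetEquality using (∼bag⇒↭)
open import Data.List.Relation.Binary.Permutation.Propositional using (_↭_)
open import Data.List.Relation.Unary.All as All using (All; []; _∷_)
import Data.List.Relation.Unary.All.Properties as AllP
open import Data.List.Relation.Unary.Any using (here; there)
open import Data.List.Relation.Unary.Unique.Propositional using (Unique; []; _∷_)
import Data.List.Relation.Unary.Unique.Propositional.Properties as Unique
open import Data.Product as Product using (Σ; ∃; _×_; _,_; proj₁; proj₂)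
open import Data.Sum as Sum using (_⊎_; inj₁; inj₂; [_,_])
open import Function using (_∘_)
open import Function.Bundles using (mk⇔)
open import Level using (0ℓ)
open import Relation.Binary.Bundles using (Setoid)
open import Relation.Binary.PropositionalEquality using (_≡_; _≢_; refl; sym; trans; cong; cong₂; subst; subst₂; module ≡-Reasoning)
import Relation.Binary.Reasoning.Setoid
open import Relation.Nullary using (¬_; contradiction; Dec; yes; no)
open import Relation.Nullary.Decidable using (map′; ¬?; decidable-stable; _×-dec_)
open import Relation.Unary using (Decidable)

open import Defs

-- Congruence modulo n

infix 4 _≡_[mod_]

-- a record rather than a synonym for u % n ≡ v % n, so that u and v can be inferred
record _≡_[mod_] (u v n : ℕ) .{{_ : NonZero n}} : Set where
  constructor mk≡[mod]
  field %-≡ : u % n ≡ v % n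

open _≡_[mod_] public

module _ {n : ℕ} .{{_ : NonZero n}} where

  ≡[mod]-refl : ∀ {u} → u ≡ u [mod n ]
  ≡[mod]-refl = mk≡[mod] refl

  ≡[mod]-sym : ∀ {u v} → u ≡ v [mod n ] → v ≡ u [mod n ]
  ≡[mod]-sym (mk≡[mod] eq) = mk≡[mod] (sym eq)

  ≡[mod]-trans : ∀ {u v w} → u ≡ v [mod n ] → v ≡ w [mod n ] → u ≡ w [mod n ]
  ≡[mod]-trans (mk≡[mod] eq) (mk≡[mod] eq′) = mk≡[mod] (trans eq eq′)

≡[mod]-setoid : (n : ℕ) .{{_ : NonZero n}} → Setoid 0ℓ 0ℓ
≡[mod]-setoid n = record
  { Carrier       = ℕ
  ; _≈_           = _≡_[mod n ]
  ; isEquivalence = record { refl = ≡[mod]-refl ; sym = ≡[mod]-sym ; trans = ≡[mod]-trans }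
  }

module ≡[mod]-Reasoning (n : ℕ) .{{_ : NonZero n}} = Relation.Binary.Reasoning.Setoid (≡[mod]-setoid n)

module _ {n : ℕ} .{{_ : NonZero n}} where

  ≡⇒≡[mod] : ∀ {u v} → u ≡ v → u ≡ v [mod n ]
  ≡⇒≡[mod] refl = ≡[mod]-refl

  %-≡[mod] : ∀ u → u % n ≡ u [mod n ]
  %-≡[mod] u = mk≡[mod] (m%n%n≡m%n u n)

  _≡[mod]?_ : ∀ u v → Dec (u ≡ v [mod n ])
  u ≡[mod]? v = map′ mk≡[mod] %-≡ (u % n ≟ v % n)

  ≡[mod]⇒≡ : ∀ {u v} → u < n → v < n → u ≡ v [mod n ] → u ≡ v
  ≡[mod]⇒≡ u<n v<n (mk≡[mod] eq) = trans (sym (m<n⇒m%n≡m u<n)) (trans eq (m<n⇒m%n≡m v<n))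

  ∣∸⇒≡[mod] : ∀ {u v} → v ≤ u → n ∣ u ∸ v → u ≡ v [mod n ]
  ∣∸⇒≡[mod] {u} {v} v≤u n∣u∸v = mk≡[mod] (trans (cong (_% n) (sym (m+[n∸m]≡n v≤u))) (%-remove-+ʳ v n∣u∸v))

  ≡[mod]⇒∣∸ : ∀ {u v} → u ≡ v [mod n ] → n ∣ u ∸ v
  ≡[mod]⇒∣∸ {u} {v} (mk≡[mod] eq) = divides (u / n ∸ v / n) (begin
      u ∸ v                                     ≡⟨ cong₂ _∸_ (m≡m%n+[m/n]*n u n) (m≡m%n+[m/n]*n v n) ⟩
      (u % n + u / n * n) ∸ (v % n + v / n * n) ≡⟨ cong (λ r → (r + u / n * n) ∸ (v % n + v / n * n)) eq ⟩
      (v % n + u / n * n) ∸ (v % n + v / n * n) ≡⟨ [m+n]∸[m+o]≡n∸o (v % n) (u / n * n) (v / n * n) ⟩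
      u / n * n ∸ v / n * n                     ≡⟨ *-distribʳ-∸ n (u / n) (v / n) ⟨
      (u / n ∸ v / n) * n                       ∎)
    where open ≡-Reasoning

  ≡[mod]⇒∣∣-∣ : ∀ {u v} → u ≡ v [mod n ] → n ∣ ∣ u - v ∣
  ≡[mod]⇒∣∣-∣ {u} {v} u≡v with ≤-total v u
  ... | inj₁ v≤u = subst (n ∣_) (sym (m≤n⇒∣n-m∣≡n∸m v≤u)) (≡[mod]⇒∣∸ u≡v)
  ... | inj₂ u≤v = subst (n ∣_) (sym (m≤n⇒∣m-n∣≡n∸m u≤v)) (≡[mod]⇒∣∸ (≡[mod]-sym u≡v))

  ∣∣-∣⇒≡[mod] : ∀ {u v} → n ∣ ∣ u - v ∣ → u ≡ v [mod n ]
  ∣∣-∣⇒≡[mod] {u} {v} n∣ with ≤-total v u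
  ... | inj₁ v≤u = ∣∸⇒≡[mod] v≤u (subst (n ∣_) (m≤n⇒∣n-m∣≡n∸m v≤u) n∣)
  ... | inj₂ u≤v = ≡[mod]-sym (∣∸⇒≡[mod] u≤v (subst (n ∣_) (m≤n⇒∣m-n∣≡n∸m u≤v) n∣))

  ≡0[mod]⇒∣ : ∀ {u} → u ≡ 0 [mod n ] → n ∣ u
  ≡0[mod]⇒∣ {u} u≡0 = subst (n ∣_) (∣-∣-identityʳ u) (≡[mod]⇒∣∣-∣ u≡0)

  ∣⇒≡0[mod] : ∀ {u} → n ∣ u → u ≡ 0 [mod n ]
  ∣⇒≡0[mod] {u} n∣u = ∣∣-∣⇒≡[mod] (subst (n ∣_) (sym (∣-∣-identityʳ u)) n∣u)

  +-cong-≡[mod] : ∀ {a b c d} → a ≡ b [mod n ] → c ≡ d [mod n ] → a + c ≡ b + d [mod n ]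
  +-cong-≡[mod] {a} {b} {c} {d} (mk≡[mod] a≡b) (mk≡[mod] c≡d) = mk≡[mod] (begin
      (a + c) % n         ≡⟨ %-distribˡ-+ a c n ⟩
      (a % n + c % n) % n ≡⟨ cong₂ (λ x y → (x + y) % n) a≡b c≡d ⟩
      (b % n + d % n) % n ≡⟨ %-distribˡ-+ b d n ⟨
      (b + d) % n         ∎)
    where open ≡-Reasoning

  *-cong-≡[mod] : ∀ {a b c d} → a ≡ b [mod n ] → c ≡ d [mod n ] → a * c ≡ b * d [mod n ]
  *-cong-≡[mod] {a} {b} {c} {d} (mk≡[mod] a≡b) (mk≡[mod] c≡d) = mk≡[mod] (begin
      (a * c) % n           ≡⟨ %-distribˡ-* a c n ⟩
      (a % n * (c % n)) % n ≡⟨ cong₂ (λ x y → (x * y) % n) a≡b c≡d ⟩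
      (b % n * (d % n)) % n ≡⟨ %-distribˡ-* b d n ⟨
      (b * d) % n           ∎)
    where open ≡-Reasoning

  +-congˡ-≡[mod] : ∀ c {a b} → a ≡ b [mod n ] → c + a ≡ c + b [mod n ]
  +-congˡ-≡[mod] c = +-cong-≡[mod] (≡[mod]-refl {u = c})

  *-congˡ-≡[mod] : ∀ c {a b} → a ≡ b [mod n ] → c * a ≡ c * b [mod n ]
  *-congˡ-≡[mod] c = *-cong-≡[mod] (≡[mod]-refl {u = c})

  +-*-≡[mod] : ∀ u k → u + n * k ≡ u [mod n ]
  +-*-≡[mod] u k = mk≡[mod] (%-remove-+ʳ u (m∣m*n k))

  ^-cong-≡[mod] : ∀ {a b} k → a ≡ b [mod n ] → a ^ k ≡ b ^ k [mod n ]
  ^-cong-≡[mod] zero    a≡b = ≡[mod]-refl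
  ^-cong-≡[mod] (suc k) a≡b = *-cong-≡[mod] a≡b (^-cong-≡[mod] k a≡b)

  +-cancelˡ-≡[mod] : ∀ a {u v} → a + u ≡ a + v [mod n ] → u ≡ v [mod n ]
  +-cancelˡ-≡[mod] a {u} {v} eq = ∣∣-∣⇒≡[mod] (subst (n ∣_) (∣m+n-m+o∣≡∣n-o∣ a u v) (≡[mod]⇒∣∣-∣ eq))

  *-cancelʳ-≡[mod] : ∀ {z u v} → Coprime n z → u * z ≡ v * z [mod n ] → u ≡ v [mod n ]
  *-cancelʳ-≡[mod] {z} {u} {v} n⊥z eq = ∣∣-∣⇒≡[mod] (coprime-divisor n⊥z
    (subst (n ∣_) (trans (sym (*-distribʳ-∣-∣ z u v)) (*-comm ∣ u - v ∣ z)) (≡[mod]⇒∣∣-∣ eq)))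

  *-cancelˡ-≡[mod] : ∀ {z u v} → Coprime n z → z * u ≡ z * v [mod n ] → u ≡ v [mod n ]
  *-cancelˡ-≡[mod] {z} {u} {v} n⊥z eq =
    *-cancelʳ-≡[mod] n⊥z (subst₂ (_≡_[mod n ]) (*-comm z u) (*-comm z v) eq)

  ≡[mod]∧/≡⇒≡ : ∀ {u v} → u ≡ v [mod n ] → u / n ≡ v / n → u ≡ v
  ≡[mod]∧/≡⇒≡ {u} {v} (mk≡[mod] u%n≡v%n) u/n≡v/n = begin
      u                   ≡⟨ m≡m%n+[m/n]*n u n ⟩
      u % n + u / n * n   ≡⟨ cong₂ (λ r q → r + q * n) u%n≡v%n u/n≡v/n ⟩
      v % n + v / n * n   ≡⟨ m≡m%n+[m/n]*n v n ⟨
      v                   ∎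
    where open ≡-Reasoning

  ^-≡1⇒^*-≡1 : ∀ x d → x ^ d ≡ 1 [mod n ] → ∀ q → x ^ (d * q) ≡ 1 [mod n ]
  ^-≡1⇒^*-≡1 x d xᵈ≡1 q = begin
      x ^ (d * q)   ≡⟨ ^-*-assoc x d q ⟨
      (x ^ d) ^ q   ≈⟨ ^-cong-≡[mod] q xᵈ≡1 ⟩
      1 ^ q         ≡⟨ ^-zeroˡ q ⟩
      1             ∎
    where open ≡[mod]-Reasoning n

  ^-≡1⇒^≡^% : ∀ x d .{{_ : NonZero d}} → x ^ d ≡ 1 [mod n ] → ∀ k → x ^ k ≡ x ^ (k % d) [mod n ]
  ^-≡1⇒^≡^% x d xᵈ≡1 k = begin
      x ^ k                            ≡⟨ cong (x ^_) (trans (m≡m%n+[m/n]*n k d) (cong (k % d +_) (*-comm (k / d) d))) ⟩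
      x ^ (k % d + d * (k / d))        ≡⟨ ^-distribˡ-+-* x (k % d) (d * (k / d)) ⟩
      x ^ (k % d) * x ^ (d * (k / d))  ≈⟨ *-congˡ-≡[mod] (x ^ (k % d)) (^-≡1⇒^*-≡1 x d xᵈ≡1 (k / d)) ⟩
      x ^ (k % d) * 1                  ≡⟨ *-identityʳ (x ^ (k % d)) ⟩
      x ^ (k % d)                      ∎
    where open ≡[mod]-Reasoning n

≡[mod]-weaken : ∀ {m n u v} .{{_ : NonZero m}} .{{_ : NonZero n}} → m ∣ n → u ≡ v [mod n ] → u ≡ v [mod m ]
≡[mod]-weaken {m} {n} {u} {v} m∣n (mk≡[mod] eq) =
  mk≡[mod] (trans (sym (m∣n⇒o%n%m≡o%m m n u m∣n)) (trans (cong (_% m) eq) (m∣n⇒o%n%m≡o%m m n v m∣n)))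

-- Elementary number theory

^-distrib-* : ∀ x y k → (x * y) ^ k ≡ x ^ k * y ^ k
^-distrib-* x y zero    = refl
^-distrib-* x y (suc k) = trans (cong (x * y *_) (^-distrib-* x y k)) (interchange x y (x ^ k) (y ^ k))
  where
  interchange : ∀ a b c d → a * b * (c * d) ≡ a * c * (b * d)
  interchange = solve-∀

prime∤⇒coprime : ∀ {q z} → Prime q → ¬ q ∣ z → Coprime q z
prime∤⇒coprime q-prime q∤z (d∣q , d∣z) with prime⇒irreducible q-prime d∣q
... | inj₁ d≡1  = d≡1
... | inj₂ refl = contradiction d∣z q∤z

coprime-*ˡ : ∀ {a b c} → Coprime a c → Coprime b c → Coprime (a * b) c
coprime-*ˡ {a} a⊥c b⊥c {i} (i∣ab , i∣c) = b⊥c (coprime-divisor i⊥a i∣ab , i∣c)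
  where
  i⊥a : Coprime i a
  i⊥a (j∣i , j∣a) = a⊥c (j∣a , ∣-trans j∣i i∣c)

coprime-^ˡ : ∀ {a c} → Coprime a c → ∀ k → Coprime (a ^ k) c
coprime-^ˡ a⊥c zero    (i∣1 , _) = ∣1⇒≡1 i∣1
coprime-^ˡ a⊥c (suc k) = coprime-*ˡ a⊥c (coprime-^ˡ a⊥c k)

coprime-∣⇒*∣ : ∀ {a b k} → Coprime a b → a ∣ k → b ∣ k → a * b ∣ k
coprime-∣⇒*∣ {a} {b} a⊥b (divides c refl) b∣ca =
  subst (a * b ∣_) (*-comm a c) (*-monoʳ-∣ a (coprime-divisor (Coprimality.sym a⊥b) (subst (b ∣_) (*-comm c a) b∣ca)))

∣prime^[1+e]⇒∣prime^e⊎≡ : ∀ {q} → Prime q → ∀ e {d} → d ∣ q ^ suc e → d ∣ q ^ e ⊎ d ≡ q ^ suc e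
∣prime^[1+e]⇒∣prime^e⊎≡ {q} q-prime e {d} d∣q^[1+e] with q ∣? d
... | no q∤d = inj₁ (coprime-divisor (Coprimality.sym (prime∤⇒coprime q-prime q∤d)) d∣q^[1+e])
... | yes (divides d′ refl) with e | *-cancelˡ-∣ q {{prime⇒nonZero q-prime}} (subst (_∣ q * q ^ e) (*-comm d′ q) d∣q^[1+e])
...   | zero   | d′∣1  = inj₂ (trans (cong (_* q) (∣1⇒≡1 d′∣1)) (*-comm 1 q))
...   | suc e′ | d′∣q^e = Sum.map (λ d′∣q^e′ → subst (d′ * q ∣_) (*-comm (q ^ e′) q) (*-monoˡ-∣ q d′∣q^e′))
                                    (λ d′≡q^e → trans (*-comm d′ q) (cong (q *_) d′≡q^e))
                                    (∣prime^[1+e]⇒∣prime^e⊎≡ q-prime e′ d′∣q^e)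

∃-prime-∣ : ∀ {d} → 2 ≤ d → ∃ λ q → Prime q × q ∣ d
∃-prime-∣ {d} 2≤d with factorise d {{>-nonZero (<-trans z<s 2≤d)}}
... | record { factors = [] ; isFactorisation = d≡1 } = contradiction d≡1 (>⇒≢ 2≤d)
... | record { factors = q ∷ qs ; isFactorisation = d≡qΠ ; factorsPrime = q-prime ∷ _ } =
  q , q-prime , divides (product qs) (trans d≡qΠ (*-comm q (product qs)))

q-adic-split : ∀ {q} → Prime q → ∀ n → .{{NonZero n}} → ∃ λ e → ∃ λ c → n ≡ q ^ e * c × ¬ q ∣ c
q-adic-split {q} q-prime = <-rec _ split
  where
  split : ∀ n → (∀ {m} → m < n → .{{NonZero m}} → ∃ λ e → ∃ λ c → m ≡ q ^ e * c × ¬ q ∣ c) →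
          .{{NonZero n}} → ∃ λ e → ∃ λ c → n ≡ q ^ e * c × ¬ q ∣ c
  split n rec with q ∣? n
  ... | no q∤n = 0 , n , sym (*-identityˡ n) , q∤n
  ... | yes (divides m refl) with rec (m<m*n m q {{m≢0}} (nonTrivial⇒n>1 q {{prime⇒nonTrivial q-prime}})) {{m≢0}}
    where
    m≢0 : NonZero m
    m≢0 = m*n≢0⇒m≢0 m
  ... | e , c , m≡qᵉc , q∤c = suc e , c , trans (cong (_* q) m≡qᵉc) (shuffle (q ^ e) c q) , q∤c
    where
    shuffle : ∀ a c q → a * c * q ≡ q * a * c
    shuffle = solve-∀

∃-prime-power-factor : ∀ {d} → 2 ≤ d → ∃ λ q → ∃ λ e → ∃ λ c → Prime q × d ≡ q ^ suc e * c × ¬ q ∣ c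
∃-prime-power-factor {d} 2≤d with ∃-prime-∣ 2≤d
... | q , q-prime , q∣d with q-adic-split q-prime d {{>-nonZero (<-trans z<s 2≤d)}}
...   | zero  , c , d≡c     , q∤c = contradiction (subst (q ∣_) (trans d≡c (*-identityˡ c)) q∣d) q∤c
...   | suc e , c , d≡qᵉ⁺¹c , q∤c = q , e , c , q-prime , d≡qᵉ⁺¹c , q∤c

∣-∣≡∣⊖∣ : ∀ m n → ∣ m - n ∣ ≡ ℤ.∣ m ⊖ n ∣
∣-∣≡∣⊖∣ m n with ≤-total m n
... | inj₁ m≤n = trans (m≤n⇒∣m-n∣≡n∸m m≤n) (sym (ℤ.∣⊖∣-≤ m≤n))
... | inj₂ n≤m = trans (m≤n⇒∣n-m∣≡n∸m n≤m) (sym (trans (ℤ.∣m⊖n∣≡∣n⊖m∣ m n) (ℤ.∣⊖∣-≤ n≤m)))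

∣-∣*∣-∣≡∣-∣ : ∀ x k l → ∣ x - k ∣ * ∣ x - l ∣ ≡ ∣ x * x + k * l - (x * k + x * l) ∣
∣-∣*∣-∣≡∣-∣ x k l = begin
  ∣ x - k ∣ * ∣ x - l ∣                      ≡⟨ cong₂ _*_ (∣-∣≡∣⊖∣ x k) (∣-∣≡∣⊖∣ x l) ⟩
  ℤ.∣ x ⊖ k ∣ * ℤ.∣ x ⊖ l ∣                  ≡⟨ ℤ.abs-* (x ⊖ k) (x ⊖ l) ⟨
  ℤ.∣ (x ⊖ k) ℤ.* (x ⊖ l) ∣                  ≡⟨ cong ℤ.∣_∣ expand ⟩
  ℤ.∣ (x * x + k * l) ⊖ (x * k + x * l) ∣    ≡⟨ ∣-∣≡∣⊖∣ (x * x + k * l) (x * k + x * l) ⟨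
  ∣ x * x + k * l - (x * k + x * l) ∣        ∎
  where
  open ≡-Reasoning
  ring : ∀ x k l → (x ℤ.- k) ℤ.* (x ℤ.- l) ≡ (x ℤ.* x ℤ.+ k ℤ.* l) ℤ.- (x ℤ.* k ℤ.+ x ℤ.* l)
  ring = ℤ-solve-∀
  +-of-*+* : ∀ a b c d → ℤ.+ (a * b + c * d) ≡ ℤ.+ a ℤ.* ℤ.+ b ℤ.+ ℤ.+ c ℤ.* ℤ.+ d
  +-of-*+* a b c d = trans (ℤ.pos-+ (a * b) (c * d)) (cong₂ ℤ._+_ (ℤ.pos-* a b) (ℤ.pos-* c d))
  expand : (x ⊖ k) ℤ.* (x ⊖ l) ≡ (x * x + k * l) ⊖ (x * k + x * l)
  expand = begin
    (x ⊖ k) ℤ.* (x ⊖ l)                                   ≡⟨ cong₂ ℤ._*_ (ℤ.[+m]-[+n]≡m⊖n x k) (ℤ.[+m]-[+n]≡m⊖n x l) ⟨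
    (ℤ.+ x ℤ.- ℤ.+ k) ℤ.* (ℤ.+ x ℤ.- ℤ.+ l)               ≡⟨ ring (ℤ.+ x) (ℤ.+ k) (ℤ.+ l) ⟩
    (ℤ.+ x ℤ.* ℤ.+ x ℤ.+ ℤ.+ k ℤ.* ℤ.+ l) ℤ.- (ℤ.+ x ℤ.* ℤ.+ k ℤ.+ ℤ.+ x ℤ.* ℤ.+ l)
                                                          ≡⟨ cong₂ ℤ._-_ (+-of-*+* x x k l) (+-of-*+* x k x l) ⟨
    ℤ.+ (x * x + k * l) ℤ.- ℤ.+ (x * k + x * l)           ≡⟨ ℤ.[+m]-[+n]≡m⊖n (x * x + k * l) (x * k + x * l) ⟩
    (x * x + k * l) ⊖ (x * k + x * l)                     ∎

-- Monic polynomials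

evalMonic : List ℕ → ℕ → ℕ
evalMonic []       x = 1
evalMonic (c ∷ cs) x = c + x * evalMonic cs x

-- the coefficients of (f(x) − f(r)) / (x − r), by synthetic division
quotientAt : ℕ → List ℕ → List ℕ
quotientAt r []                = []
quotientAt r (c ∷ [])          = []
quotientAt r (c ∷ cs@(_ ∷ _)) = evalMonic cs r ∷ quotientAt r cs

length-quotientAt : ∀ r c cs → length (quotientAt r (c ∷ cs)) ≡ length cs
length-quotientAt r c []       = refl
length-quotientAt r c (d ∷ cs) = cong suc (length-quotientAt r d cs)

-- f(x) − f(r) = (x − r) q(x), with both sides moved so that no subtraction occurs
evalMonic-quotientAt : ∀ r c cs x →
  evalMonic (c ∷ cs) x + r * evalMonic (quotientAt r (c ∷ cs)) x ≡ x * evalMonic (quotientAt r (c ∷ cs)) x + evalMonic (c ∷ cs) r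
evalMonic-quotientAt r c []       x = linear c x r
  where
  linear : ∀ c x r → c + x * 1 + r * 1 ≡ x * 1 + (c + r * 1)
  linear = solve-∀
evalMonic-quotientAt r c (d ∷ cs) x = begin
    c + x * g x + r * (g r + x * q x)   ≡⟨ regroup c x r (g x) (g r) (q x) ⟩
    c + r * g r + x * (g x + r * q x)   ≡⟨ cong (λ y → c + r * g r + x * y) (evalMonic-quotientAt r d cs x) ⟩
    c + r * g r + x * (x * q x + g r)   ≡⟨ rotate c x r (g r) (q x) ⟩
    x * (g r + x * q x) + (c + r * g r) ∎
  where
  open ≡-Reasoning
  g q : ℕ → ℕ
  g = evalMonic (d ∷ cs)
  q = evalMonic (quotientAt r (d ∷ cs))
  regroup : ∀ c x r gx gr qx → c + x * gx + r * (gr + x * qx) ≡ c + r * gr + x * (gx + r * qx)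
  regroup = solve-∀
  rotate : ∀ c x r gr qx → c + r * gr + x * (x * qx + gr) ≡ x * (gr + x * qx) + (c + r * gr)
  rotate = solve-∀

evalMonic-replicate-0 : ∀ k x → evalMonic (replicate k 0) x ≡ x ^ k
evalMonic-replicate-0 zero    x = refl
evalMonic-replicate-0 (suc k) x = cong (x *_) (evalMonic-replicate-0 k x)

-- Subsets of Fin n and representations in ℤ_N

∣⁅x⁆∪p∣≡1+∣p∣ : ∀ {n} (x : Fin n) (p : Subset n) → x ∉ p → ∣ ⁅ x ⁆ ∪ p ∣ ≡ suc ∣ p ∣
∣⁅x⁆∪p∣≡1+∣p∣ Fin.zero    (inside  ∷ p) x∉p = contradiction Vec.here x∉p
∣⁅x⁆∪p∣≡1+∣p∣ Fin.zero    (outside ∷ p) _   = cong (suc ∘ ∣_∣) (∪-identityˡ p)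
∣⁅x⁆∪p∣≡1+∣p∣ (Fin.suc x) (inside  ∷ p) x∉p = cong suc (∣⁅x⁆∪p∣≡1+∣p∣ x p (x∉p ∘ Vec.there))
∣⁅x⁆∪p∣≡1+∣p∣ (Fin.suc x) (outside ∷ p) x∉p = ∣⁅x⁆∪p∣≡1+∣p∣ x p (x∉p ∘ Vec.there)

module _ {n : ℕ} where

  ∈-⋃⁅⁆⁻ : ∀ {x : Fin n} xs → x ∈ₛ ⋃ (map ⁅_⁆ xs) → x ∈ xs
  ∈-⋃⁅⁆⁻ []       x∈⊥ = contradiction x∈⊥ ∉⊥
  ∈-⋃⁅⁆⁻ (y ∷ ys) x∈  = [ here ∘ x∈⁅y⁆⇒x≡y y , there ∘ ∈-⋃⁅⁆⁻ ys ] (x∈p∪q⁻ ⁅ y ⁆ _ x∈)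

  ∣⋃⁅⁆∣≡length : ∀ {xs : List (Fin n)} → Unique xs → ∣ ⋃ (map ⁅_⁆ xs) ∣ ≡ length xs
  ∣⋃⁅⁆∣≡length {[]}     []              = ∣⊥∣≡0 n
  ∣⋃⁅⁆∣≡length {x ∷ xs} (x∉xs ∷ unique) =
    trans (∣⁅x⁆∪p∣≡1+∣p∣ x _ (λ x∈ → All.lookup x∉xs (∈-⋃⁅⁆⁻ xs x∈) refl)) (cong suc (∣⋃⁅⁆∣≡length unique))

  unique⇒length≤ : ∀ {xs : List (Fin n)} → Unique xs → length xs ≤ n
  unique⇒length≤ {xs} unique = subst (_≤ n) (∣⋃⁅⁆∣≡length unique) (∣p∣≤n (⋃ (map ⁅_⁆ xs)))

  module _ {X : Set} {P : X → Set} (key : ∀ {x} → P x → Fin n)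
           (key-injective : ∀ {x y} (px : P x) (py : P y) → key px ≡ key py → x ≡ y) where

    length-reduce : ∀ {xs} (pxs : All P xs) → length (All.reduce key pxs) ≡ length xs
    length-reduce []         = refl
    length-reduce (_ ∷ pxs) = cong suc (length-reduce pxs)

    unique-reduce : ∀ {xs} (pxs : All P xs) → Unique xs → Unique (All.reduce key pxs)
    unique-reduce []                   []               = []
    unique-reduce {x ∷ _} (px ∷ pxs) (x∉xs ∷ unique) = fresh pxs x∉xs ∷ unique-reduce pxs unique
      where
      fresh : ∀ {ys} (pys : All P ys) → All (x ≢_) ys → All (key px ≢_) (All.reduce key pys)
      fresh []          []            = []
      fresh (py ∷ pys) (x≢y ∷ x∉ys) = (x≢y ∘ key-injective px py) ∷ fresh pys x∉ys

    unique⇒length≤-by-key : ∀ {xs} → Unique xs → All P xs → length xs ≤ n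
    unique⇒length≤-by-key unique pxs = subst (_≤ n) (length-reduce pxs) (unique⇒length≤ (unique-reduce pxs unique))

toℕ-mod-+ₘ-mod : ∀ {N} .{{_ : NonZero N}} u v → toℕ ((u mod N) +ₘ (v mod N)) ≡ (u + v) % N
toℕ-mod-+ₘ-mod {suc n} u v = begin
    toℕ ((u mod N) +ₘ (v mod N))             ≡⟨ toℕ-fromℕ< _ ⟩
    (toℕ (u mod N) + toℕ (v mod N)) % N      ≡⟨ cong₂ (λ x y → (x + y) % N) (toℕ-fromℕ< (m%n<n u N)) (toℕ-fromℕ< (m%n<n v N)) ⟩
    (u % N + v % N) % N                      ≡⟨ %-distribˡ-+ u v N ⟨
    (u + v) % N                              ∎
  where
  open ≡-Reasoning
  N = suc n

mod-injective : ∀ {N} .{{_ : NonZero N}} {u v} → u mod N ≡ v mod N → u ≡ v [mod N ]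
mod-injective {N} {u} {v} eq = mk≡[mod] (trans (sym (toℕ-fromℕ< (m%n<n u N))) (trans (cong toℕ eq) (toℕ-fromℕ< (m%n<n v N))))

mod-+ₘ-injective : ∀ {N} .{{_ : NonZero N}} {u v w z} → (u mod N) +ₘ (v mod N) ≡ (w mod N) +ₘ (z mod N) →
  u + v ≡ w + z [mod N ]
mod-+ₘ-injective {u = u} {v} {w} {z} eq =
  mk≡[mod] (trans (sym (toℕ-mod-+ₘ-mod u v)) (trans (cong toℕ eq) (toℕ-mod-+ₘ-mod w z)))

ordered-pair-≡ : ∀ {N} {a₁ a₂ c₁ c₂ : Fin N} → toℕ a₁ ≤ toℕ a₂ → toℕ c₁ ≤ toℕ c₂ →
  (a₁ ≡ c₁ × a₂ ≡ c₂) ⊎ (a₁ ≡ c₂ × a₂ ≡ c₁) → (a₁ , a₂) ≡ (c₁ , c₂)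
ordered-pair-≡ _     _     (inj₁ (refl , refl)) = refl
ordered-pair-≡ a₁≤a₂ a₂≤a₁ (inj₂ (refl , refl)) with toℕ-injective (≤-antisym a₁≤a₂ a₂≤a₁)
... | refl = refl

module _ {N : ℕ} (A : Subset N) (b : Fin N) where

  IsRep : Fin N × Fin N → Set
  IsRep (a₁ , a₂) = toℕ a₁ ≤ toℕ a₂ × a₁ ∈ₛ A × a₂ ∈ₛ A × a₁ +ₘ a₂ ≡ b

  reps2≤ : ∀ {g} (key : ∀ {x} → IsRep x → Fin g) →
    (∀ {x y} (rx : IsRep x) (ry : IsRep y) → key rx ≡ key ry → x ≡ y) → reps2 A b ≤ g
  reps2≤ key key-injective = unique⇒length≤-by-key key key-injective
    (Unique.filter⁺ isRep? (Unique.cartesianProduct⁺ (Unique.allFin⁺ N) (Unique.allFin⁺ N)))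
    (AllP.all-filter isRep? (cartesianProduct (allFin N) (allFin N)))
    where
    -- reps2 filters with exactly this decision procedure
    isRep? : Decidable IsRep
    isRep? (a₁ , a₂) = (toℕ a₁ ≤? toℕ a₂) ×-dec ((a₁ ∈? A) ×-dec ((a₂ ∈? A) ×-dec ((a₁ +ₘ a₂) Fin.≟ b)))

-- Arithmetic modulo a prime

module ModuloPrime {p : ℕ} (p-prime : Prime p) where

  instance
    p≢0 : NonZero p
    p≢0 = prime⇒nonZero p-prime

  1<p : 1 < p
  1<p = nonTrivial⇒n>1 p {{prime⇒nonTrivial p-prime}}

  p∤1 : ¬ p ∣ 1
  p∤1 p∣1 = ¬prime[1] (subst Prime (∣1⇒≡1 p∣1) p-prime)

  ∤⇒coprime : ∀ {z} → ¬ p ∣ z → Coprime p z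
  ∤⇒coprime = prime∤⇒coprime p-prime

  ∤-* : ∀ {a b} → ¬ p ∣ a → ¬ p ∣ b → ¬ p ∣ a * b
  ∤-* {a} {b} p∤a p∤b p∣ab = [ p∤a , p∤b ] (euclidsLemma a b p-prime p∣ab)

  ∤-product : ∀ {xs} → All (λ x → ¬ p ∣ x) xs → ¬ p ∣ product xs
  ∤-product []            = p∤1
  ∤-product (p∤x ∷ p∤xs) = ∤-* p∤x (∤-product p∤xs)

  ∤-^ : ∀ {x} → ¬ p ∣ x → ∀ k → ¬ p ∣ x ^ k
  ∤-^ p∤x zero    = p∤1
  ∤-^ p∤x (suc k) = ∤-* p∤x (∤-^ p∤x k)

  ∤-% : ∀ {x} → ¬ p ∣ x → ¬ p ∣ x % p
  ∤-% p∤x p∣x%p = p∤x (∣n∣m%n⇒∣m ∣-refl p∣x%p)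

  unit : Fin (p ∸ 1) → ℕ
  unit i = suc (toℕ i)

  units : List ℕ
  units = tabulate unit

  unit<p : ∀ i → unit i < p
  unit<p i = subst (unit i <_) (suc-pred p) (s≤s (toℕ<n i))

  p∤unit : ∀ i → ¬ p ∣ unit i
  p∤unit i = >⇒∤ (unit<p i)

  unit-injective : ∀ {i j} → unit i ≡ unit j → i ≡ j
  unit-injective = toℕ-injective ∘ suc-injective

  unique-units : Unique units
  unique-units = Unique.tabulate⁺ unit-injective

  ∈-units : ∀ {x} → ¬ p ∣ x → x < p → x ∈ units
  ∈-units {zero}  p∤0 _   = contradiction (p ∣0) p∤0
  ∈-units {suc x} _   x<p = subst (_∈ units) (cong suc (toℕ-fromℕ< x<p∸1)) (∈-tabulate⁺ (fromℕ< x<p∸1))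
    where
    x<p∸1 : x < p ∸ 1
    x<p∸1 = s≤s⁻¹ (subst (suc x <_) (sym (suc-pred p)) x<p)

  ∈-units⁻ : ∀ {x} → x ∈ units → ¬ p ∣ x × x < p
  ∈-units⁻ x∈units with ∈-tabulate⁻ x∈units
  ... | i , refl = p∤unit i , unit<p i

  *%-∈-units : ∀ {c x} → ¬ p ∣ c → x ∈ units → x * c % p ∈ units
  *%-∈-units p∤c x∈units = ∈-units (∤-% (∤-* (proj₁ (∈-units⁻ x∈units)) p∤c)) (m%n<n _ p)

  1≢0[mod] : ¬ 1 ≡ 0 [mod p ]
  1≢0[mod] = p∤1 ∘ ≡0[mod]⇒∣

  ≡0[mod]-root-of-quotientAt : ∀ c cs {r s} → r < p → s < p → r ≢ s →
    evalMonic (c ∷ cs) r ≡ 0 [mod p ] → evalMonic (c ∷ cs) s ≡ 0 [mod p ] →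
    evalMonic (quotientAt r (c ∷ cs)) s ≡ 0 [mod p ]
  ≡0[mod]-root-of-quotientAt c cs {r} {s} r<p s<p r≢s fr≡0 fs≡0 with p ∣? q
    where q = evalMonic (quotientAt r (c ∷ cs)) s
  ... | yes p∣q = ∣⇒≡0[mod] p∣q
  ... | no  p∤q = contradiction (≡[mod]⇒≡ r<p s<p (*-cancelʳ-≡[mod] (∤⇒coprime p∤q) rq≡sq)) r≢s
    where
    q = evalMonic (quotientAt r (c ∷ cs)) s
    rq≡sq : r * q ≡ s * q [mod p ]
    rq≡sq = begin
      0 + r * q                         ≈⟨ +-cong-≡[mod] (≡[mod]-sym fs≡0) ≡[mod]-refl ⟩
      evalMonic (c ∷ cs) s + r * q      ≡⟨ evalMonic-quotientAt r c cs s ⟩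
      s * q + evalMonic (c ∷ cs) r      ≈⟨ +-congˡ-≡[mod] (s * q) fr≡0 ⟩
      s * q + 0                         ≡⟨ +-identityʳ (s * q) ⟩
      s * q                             ∎
      where open ≡[mod]-Reasoning p

  roots-bound : ∀ cs {rs} → Unique rs → (∀ {r} → r ∈ rs → r < p × evalMonic cs r ≡ 0 [mod p ]) →
    length rs ≤ length cs
  roots-bound cs       []                 _     = z≤n
  roots-bound []       (_ ∷ _)            roots = contradiction (proj₂ (roots (here refl))) 1≢0[mod]
  roots-bound (c ∷ cs) {r ∷ rs} (r∉rs ∷ unique) roots =
    s≤s (subst (length rs ≤_) (length-quotientAt r c cs) (roots-bound (quotientAt r (c ∷ cs)) unique roots-of-quotient))
    where
    roots-of-quotient : ∀ {s} → s ∈ rs → s < p × evalMonic (quotientAt r (c ∷ cs)) s ≡ 0 [mod p ]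
    roots-of-quotient s∈rs with roots (here refl) | roots (there s∈rs)
    ... | r<p , fr≡0 | s<p , fs≡0 = s<p , ≡0[mod]-root-of-quotientAt c cs r<p s<p (All.lookup r∉rs s∈rs) fr≡0 fs≡0

  -- the roots of x^(1+k) ≡ 1 are those of the monic polynomial (p − 1) + x^(1+k)
  ^≡1-roots-bound : ∀ k → (∀ i → unit i ^ suc k ≡ 1 [mod p ]) → p ∸ 1 ≤ suc k
  ^≡1-roots-bound k all-roots = subst₂ _≤_ (length-tabulate unit) (cong suc (length-replicate k))
    (roots-bound ((p ∸ 1) ∷ replicate k 0) unique-units root)
    where
    root : ∀ {x} → x ∈ units → x < p × evalMonic ((p ∸ 1) ∷ replicate k 0) x ≡ 0 [mod p ]
    root x∈units with ∈-tabulate⁻ x∈units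
    ... | i , refl = unit<p i , (begin
      p ∸ 1 + unit i * evalMonic (replicate k 0) (unit i) ≡⟨ cong (λ y → p ∸ 1 + unit i * y) (evalMonic-replicate-0 k (unit i)) ⟩
      p ∸ 1 + unit i ^ suc k                              ≈⟨ +-congˡ-≡[mod] (p ∸ 1) (all-roots i) ⟩
      p ∸ 1 + 1                                           ≡⟨ m∸n+n≡m (<⇒≤ 1<p) ⟩
      p                                                   ≈⟨ ∣⇒≡0[mod] ∣-refl ⟩
      0                                                   ∎)
      where open ≡[mod]-Reasoning p

  ∃-unit-^≢1 : ∀ {k} → 0 < k → k < p ∸ 1 → ∃ λ x → ¬ p ∣ x × ¬ x ^ k ≡ 1 [mod p ]
  ∃-unit-^≢1 {suc k} _ 1+k<p∸1 with ¬∀⟶∃¬ (p ∸ 1) (λ i → unit i ^ suc k ≡ 1 [mod p ]) (λ i → _ ≡[mod]? _)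
                              (λ all-roots → <⇒≱ 1+k<p∸1 (^≡1-roots-bound k all-roots))
  ... | i , unitⁱ≢1 = unit i , p∤unit i , unitⁱ≢1

  inverse : ∀ {a} → ¬ p ∣ a → ∃ λ u → u * a ≡ 1 [mod p ]
  inverse {a} p∤a with coprime-Bézout (∤⇒coprime p∤a)
  ... | Bézout.-+ x y 1+xp≡ya = y , ≡[mod]-trans (≡⇒≡[mod] (sym 1+xp≡ya)) (mk≡[mod] ([m+kn]%n≡m%n 1 x p))
  ... | Bézout.+- x y 1+ya≡xp = (p ∸ 1) * y , ≡[mod]-trans (≡⇒≡[mod] (*-assoc (p ∸ 1) y a)) (+-cancelˡ-≡[mod] t (begin
      t + (p ∸ 1) * t  ≡⟨ cong (_* t) (suc-pred p) ⟩
      p * t            ≈⟨ ∣⇒≡0[mod] (m∣m*n t) ⟩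
      0                ≈⟨ ∣⇒≡0[mod] (n∣m*n x) ⟨
      x * p            ≡⟨ trans (sym 1+ya≡xp) (+-comm 1 t) ⟩
      t + 1            ∎))
    where
    open ≡[mod]-Reasoning p
    t = y * a

  module _ {a} (p∤a : ¬ p ∣ a) where
    private
      scale : ℕ → ℕ
      scale x = x * a % p

      scale-∈-units : ∀ {x} → x ∈ units → scale x ∈ units
      scale-∈-units = *%-∈-units p∤a

      map-scale-⊆-units : ∀ {x} → x ∈ map scale units → x ∈ units
      map-scale-⊆-units x∈ with ∈-map⁻ scale x∈
      ... | y , y∈units , refl = scale-∈-units y∈units

      units-⊆-map-scale : ∀ {y} → y ∈ units → y ∈ map scale units
      units-⊆-map-scale {y} y∈units = subst (_∈ map scale units) scale-z≡y (∈-map⁺ scale z∈units)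
        where
        u = proj₁ (inverse p∤a)
        ua≡1 = proj₂ (inverse p∤a)
        p∤u : ¬ p ∣ u
        p∤u p∣u = 1≢0[mod] (≡[mod]-trans (≡[mod]-sym ua≡1) (∣⇒≡0[mod] (∣m⇒∣m*n a p∣u)))
        z = y * u % p
        z∈units : z ∈ units
        z∈units = *%-∈-units p∤u y∈units
        za≡y : z * a ≡ y [mod p ]
        za≡y = begin
          y * u % p * a  ≈⟨ *-cong-≡[mod] (%-≡[mod] (y * u)) ≡[mod]-refl ⟩
          y * u * a      ≡⟨ *-assoc y u a ⟩
          y * (u * a)    ≈⟨ *-congˡ-≡[mod] y ua≡1 ⟩
          y * 1          ≡⟨ *-identityʳ y ⟩
          y              ∎
          where open ≡[mod]-Reasoning p
        scale-z≡y : scale z ≡ y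
        scale-z≡y = trans (%-≡ za≡y) (m<n⇒m%n≡m (proj₂ (∈-units⁻ y∈units)))

      scale-injective : ∀ {i j} → scale (unit i) ≡ scale (unit j) → i ≡ j
      scale-injective {i} {j} eq =
        unit-injective (≡[mod]⇒≡ (unit<p i) (unit<p j) (*-cancelʳ-≡[mod] (∤⇒coprime p∤a) (mk≡[mod] eq)))

      scale-units↭units : map scale units ↭ units
      scale-units↭units = ∼bag⇒↭ (unique∧set⇒bag
        (subst Unique (sym (map-tabulate unit scale)) (Unique.tabulate⁺ scale-injective))
        unique-units
        (mk⇔ map-scale-⊆-units units-⊆-map-scale))

      product-map-scale : ∀ xs → product (map scale xs) ≡ a ^ length xs * product xs [mod p ]
      product-map-scale []       = ≡[mod]-refl
      product-map-scale (x ∷ xs) = begin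
        scale x * product (map scale xs)         ≈⟨ *-cong-≡[mod] (%-≡[mod] (x * a)) (product-map-scale xs) ⟩
        x * a * (a ^ length xs * product xs)     ≡⟨ regroup x a (a ^ length xs) (product xs) ⟩
        a * a ^ length xs * (x * product xs)     ∎
        where
        open ≡[mod]-Reasoning p
        regroup : ∀ x a b c → x * a * (b * c) ≡ a * b * (x * c)
        regroup = solve-∀

    fermat : a ^ (p ∸ 1) ≡ 1 [mod p ]
    fermat = ≡[mod]-sym (*-cancelʳ-≡[mod] (∤⇒coprime (∤-product (AllP.tabulate⁺ p∤unit))) (begin
      1 * product units              ≡⟨ *-identityˡ (product units) ⟩
      product units                  ≡⟨ product-↭ scale-units↭units ⟨
      product (map scale units)      ≈⟨ product-map-scale units ⟩
      a ^ length units * product units ≡⟨ cong (λ k → a ^ k * product units) (length-tabulate unit) ⟩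
      a ^ (p ∸ 1) * product units    ∎))
      where open ≡[mod]-Reasoning p

  record _HasOrder_ (x d : ℕ) : Set where
    field
      ^≡1⇒∣ : ∀ k → x ^ k ≡ 1 [mod p ] → d ∣ k
      ∣⇒^≡1 : ∀ {k} → d ∣ k → x ^ k ≡ 1 [mod p ]

  open _HasOrder_ public

  hasOrder⇒^≡1 : ∀ {x d} → x HasOrder d → x ^ d ≡ 1 [mod p ]
  hasOrder⇒^≡1 x-ord = ∣⇒^≡1 x-ord ∣-refl

  hasOrder⇒p∤ : ∀ {x d} .{{_ : NonZero d}} → x HasOrder d → ¬ p ∣ x
  hasOrder⇒p∤ {x} {suc d} x-ord p∣x =
    1≢0[mod] (≡[mod]-trans (≡[mod]-sym (hasOrder⇒^≡1 x-ord)) (∣⇒≡0[mod] (∣m⇒∣m*n (x ^ d) p∣x)))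

  minimal⇒hasOrder : ∀ {x d} → x ^ suc d ≡ 1 [mod p ] → (∀ k → k < d → ¬ x ^ suc k ≡ 1 [mod p ]) →
    x HasOrder suc d
  minimal⇒hasOrder {x} {d} x^[1+d]≡1 minimal = record { ^≡1⇒∣ = to ; ∣⇒^≡1 = from }
    where
    from : ∀ {k} → suc d ∣ k → x ^ k ≡ 1 [mod p ]
    from (divides q refl) = subst (λ e → x ^ e ≡ 1 [mod p ]) (*-comm (suc d) q) (^-≡1⇒^*-≡1 x (suc d) x^[1+d]≡1 q)
    to : ∀ k → x ^ k ≡ 1 [mod p ] → suc d ∣ k
    to k xᵏ≡1 with k % suc d in k%[1+d]≡r | ^-≡1⇒^≡^% x (suc d) x^[1+d]≡1 k
    ... | zero  | _       = m%n≡0⇒n∣m k (suc d) k%[1+d]≡r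
    ... | suc r | xᵏ≡xʳ⁺¹ = contradiction (≡[mod]-trans (≡[mod]-sym xᵏ≡xʳ⁺¹) xᵏ≡1)
                              (minimal r (s<s⁻¹ (subst (_< suc d) k%[1+d]≡r (m%n<n k (suc d)))))

  ∃-order : ∀ {x n} .{{_ : NonZero n}} → x ^ n ≡ 1 [mod p ] → ∃ (x HasOrder_)
  ∃-order {x} {suc n} xⁿ≡1 with ¬∀⟶∃¬-smallest (suc n) (λ i → ¬ x ^ suc (toℕ i) ≡ 1 [mod p ])
                                   (λ i → ¬? (_ ≡[mod]? _)) (λ all → all (fromℕ n) xⁿ≡1′)
    where
    xⁿ≡1′ : x ^ suc (toℕ (fromℕ n)) ≡ 1 [mod p ]
    xⁿ≡1′ = subst (λ e → x ^ suc e ≡ 1 [mod p ]) (sym (toℕ-fromℕ n)) xⁿ≡1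
  ... | i , ¬¬xⁱ⁺¹≡1 , below-i = suc (toℕ i) , minimal⇒hasOrder (decidable-stable (_ ≡[mod]? _) ¬¬xⁱ⁺¹≡1) minimal
    where
    minimal : ∀ k → k < toℕ i → ¬ x ^ suc k ≡ 1 [mod p ]
    minimal k k<i = subst (λ e → ¬ x ^ suc e ≡ 1 [mod p ])
      (trans (toℕ-inject (fromℕ< k<i)) (toℕ-fromℕ< k<i)) (below-i (fromℕ< k<i))

  hasOrder-* : ∀ {x y a b} → x HasOrder a → y HasOrder b → Coprime a b → (x * y) HasOrder (a * b)
  hasOrder-* {x} {y} {a} {b} x-ord y-ord a⊥b = record { ^≡1⇒∣ = to ; ∣⇒^≡1 = from }
    where
    from : ∀ {k} → a * b ∣ k → (x * y) ^ k ≡ 1 [mod p ]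
    from {k} ab∣k = begin
      (x * y) ^ k    ≡⟨ ^-distrib-* x y k ⟩
      x ^ k * y ^ k  ≈⟨ *-cong-≡[mod] (∣⇒^≡1 x-ord (m*n∣⇒m∣ a b ab∣k)) (∣⇒^≡1 y-ord (m*n∣⇒n∣ a b ab∣k)) ⟩
      1              ∎
      where open ≡[mod]-Reasoning p
    -- raising to the power k * d kills the factor of order d
    factor-∣ : ∀ {u v c d} k → u HasOrder c → v HasOrder d → (u * v) ^ k ≡ 1 [mod p ] → c ∣ d * k
    factor-∣ {u} {v} {c} {d} k u-ord v-ord uvᵏ≡1 = subst (c ∣_) (*-comm k d) (^≡1⇒∣ u-ord (k * d) (begin
      u ^ (k * d)                   ≡⟨ *-identityʳ _ ⟨
      u ^ (k * d) * 1               ≈⟨ *-congˡ-≡[mod] (u ^ (k * d)) (∣⇒^≡1 v-ord (n∣m*n k)) ⟨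
      u ^ (k * d) * v ^ (k * d)     ≡⟨ ^-distrib-* u v (k * d) ⟨
      (u * v) ^ (k * d)             ≈⟨ ^-≡1⇒^*-≡1 (u * v) k uvᵏ≡1 d ⟩
      1                             ∎))
      where open ≡[mod]-Reasoning p
    to : ∀ k → (x * y) ^ k ≡ 1 [mod p ] → a * b ∣ k
    to k xyᵏ≡1 = coprime-∣⇒*∣ a⊥b
      (coprime-divisor a⊥b (factor-∣ k x-ord y-ord xyᵏ≡1))
      (coprime-divisor (Coprimality.sym a⊥b) (factor-∣ k y-ord x-ord (subst (λ z → z ^ k ≡ 1 [mod p ]) (*-comm x y) xyᵏ≡1)))

  hasOrder⇒^≡^ : ∀ {x d i j} .{{_ : NonZero d}} → x HasOrder d → i ≡ j [mod d ] → x ^ i ≡ x ^ j [mod p ]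
  hasOrder⇒^≡^ {x} {d} {i} {j} x-ord (mk≡[mod] i%d≡j%d) = begin
      x ^ i          ≈⟨ ^-≡1⇒^≡^% x d (hasOrder⇒^≡1 x-ord) i ⟩
      x ^ (i % d)    ≡⟨ cong (x ^_) i%d≡j%d ⟩
      x ^ (j % d)    ≈⟨ ^-≡1⇒^≡^% x d (hasOrder⇒^≡1 x-ord) j ⟨
      x ^ j          ∎
    where open ≡[mod]-Reasoning p

  hasOrder⇒∣∸ : ∀ {x d i j} .{{_ : NonZero d}} → x HasOrder d → i ≤ j → x ^ i ≡ x ^ j [mod p ] → d ∣ j ∸ i
  hasOrder⇒∣∸ {x} {d} {i} {j} x-ord i≤j xⁱ≡xʲ = ^≡1⇒∣ x-ord (j ∸ i)
    (*-cancelʳ-≡[mod] (∤⇒coprime (∤-^ (hasOrder⇒p∤ x-ord) i)) (begin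
      x ^ (j ∸ i) * x ^ i   ≡⟨ ^-distribˡ-+-* x (j ∸ i) i ⟨
      x ^ (j ∸ i + i)       ≡⟨ cong (x ^_) (m∸n+n≡m i≤j) ⟩
      x ^ j                 ≈⟨ xⁱ≡xʲ ⟨
      x ^ i                 ≡⟨ *-identityˡ (x ^ i) ⟨
      1 * x ^ i             ∎))
    where open ≡[mod]-Reasoning p

  hasOrder⇒^-injective : ∀ {x d i j} .{{_ : NonZero d}} → x HasOrder d → x ^ i ≡ x ^ j [mod p ] → i ≡ j [mod d ]
  hasOrder⇒^-injective {i = i} {j} x-ord xⁱ≡xʲ with ≤-total i j
  ... | inj₁ i≤j = ≡[mod]-sym (∣∸⇒≡[mod] i≤j (hasOrder⇒∣∸ x-ord i≤j xⁱ≡xʲ))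
  ... | inj₂ j≤i = ∣∸⇒≡[mod] j≤i (hasOrder⇒∣∸ x-ord j≤i (≡[mod]-sym xⁱ≡xʲ))

  hasOrder-prime-power : ∀ {y q} → Prime q → ∀ e → y ^ (q ^ suc e) ≡ 1 [mod p ] → ¬ y ^ (q ^ e) ≡ 1 [mod p ] →
    y HasOrder (q ^ suc e)
  hasOrder-prime-power {y} {q} q-prime e y^qᵉ⁺¹≡1 y^qᵉ≢1
    with ∃-order {{m^n≢0 q (suc e) {{prime⇒nonZero q-prime}}}} y^qᵉ⁺¹≡1
  ... | d , y-ord with ∣prime^[1+e]⇒∣prime^e⊎≡ q-prime e (^≡1⇒∣ y-ord (q ^ suc e) y^qᵉ⁺¹≡1)
  ...   | inj₁ d∣qᵉ  = contradiction (∣⇒^≡1 y-ord d∣qᵉ) y^qᵉ≢1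
  ...   | inj₂ d≡qᵉ⁺¹ = subst (y HasOrder_) d≡qᵉ⁺¹ y-ord

  0<p∸1 : 0 < p ∸ 1
  0<p∸1 = ∸-monoˡ-< 1<p ≤-refl

  ∃-order-prime-power : ∀ {q} → Prime q → ∀ e {c} → q ^ suc e * c ≡ p ∸ 1 → ∃ (_HasOrder (q ^ suc e))
  ∃-order-prime-power {q} q-prime e {c} qᵉ⁺¹c≡p∸1 with ∃-unit-^≢1 0<k k<p∸1
    where
    k = q ^ e * c
    qk≡p∸1 : q * k ≡ p ∸ 1
    qk≡p∸1 = trans (sym (*-assoc q (q ^ e) c)) qᵉ⁺¹c≡p∸1
    0<k : 0 < k
    0<k = n≢0⇒n>0 (λ k≡0 → >⇒≢ 0<p∸1 (trans (sym qk≡p∸1) (trans (cong (q *_) k≡0) (*-zeroʳ q))))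
    k<p∸1 : k < p ∸ 1
    k<p∸1 = subst (k <_) (trans (*-comm k q) qk≡p∸1)
      (m<m*n k q {{>-nonZero 0<k}} (nonTrivial⇒n>1 q {{prime⇒nonTrivial q-prime}}))
  ... | x , p∤x , xᵏ≢1 = x ^ c , hasOrder-prime-power q-prime e y^qᵉ⁺¹≡1 y^qᵉ≢1
    where
    y^qᵉ⁺¹≡1 : (x ^ c) ^ (q ^ suc e) ≡ 1 [mod p ]
    y^qᵉ⁺¹≡1 = begin
      (x ^ c) ^ (q ^ suc e) ≡⟨ ^-*-assoc x c (q ^ suc e) ⟩
      x ^ (c * q ^ suc e)   ≡⟨ cong (x ^_) (trans (*-comm c (q ^ suc e)) qᵉ⁺¹c≡p∸1) ⟩
      x ^ (p ∸ 1)           ≈⟨ fermat p∤x ⟩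
      1                     ∎
      where open ≡[mod]-Reasoning p
    y^qᵉ≢1 : ¬ (x ^ c) ^ (q ^ e) ≡ 1 [mod p ]
    y^qᵉ≢1 = xᵏ≢1 ∘ subst (λ z → z ≡ 1 [mod p ]) (trans (^-*-assoc x c (q ^ e)) (cong (x ^_) (*-comm c (q ^ e))))

  ∃-order-∣p∸1 : ∀ d → d ∣ p ∸ 1 → ∃ (_HasOrder d)
  ∃-order-∣p∸1 = <-rec _ build
    where
    build : ∀ d → (∀ {d′} → d′ < d → d′ ∣ p ∸ 1 → ∃ (_HasOrder d′)) → d ∣ p ∸ 1 → ∃ (_HasOrder d)
    build zero                _   0∣p∸1 = contradiction (0∣⇒≡0 0∣p∸1) (>⇒≢ 0<p∸1)
    build (suc zero)          _   _     =
      1 , record { ^≡1⇒∣ = λ k _ → 1∣ k ; ∣⇒^≡1 = λ {k} _ → ≡⇒≡[mod] (^-zeroˡ k) }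
    build d@(suc (suc _)) rec d∣p∸1 with ∃-prime-power-factor (s≤s (s≤s z≤n))
    ... | q , e , c , q-prime , d≡qᵉ⁺¹c , q∤c =
      let y , y-ord = ∃-order-prime-power q-prime e qᵉ⁺¹[ct]≡p∸1
          z , z-ord = rec c<d (∣-trans (divides (q ^ suc e) d≡qᵉ⁺¹c) d∣p∸1)
      in  y * z , subst ((y * z) HasOrder_) (sym d≡qᵉ⁺¹c)
                    (hasOrder-* y-ord z-ord (coprime-^ˡ (prime∤⇒coprime q-prime q∤c) (suc e)))
      where
      t = quotient d∣p∸1
      qᵉ⁺¹[ct]≡p∸1 : q ^ suc e * (c * t) ≡ p ∸ 1
      qᵉ⁺¹[ct]≡p∸1 = begin
        q ^ suc e * (c * t) ≡⟨ *-assoc (q ^ suc e) c t ⟨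
        q ^ suc e * c * t   ≡⟨ cong (_* t) d≡qᵉ⁺¹c ⟨
        d * t               ≡⟨ *-comm d t ⟩
        t * d               ≡⟨ m∣n⇒n≡quotient*m d∣p∸1 ⟨
        p ∸ 1               ∎
        where open ≡-Reasoning
      c<d : c < d
      c<d = quotient-< (divides c (trans d≡qᵉ⁺¹c (*-comm (q ^ suc e) c)))
        {{n>1⇒nonTrivial (^-monoʳ-< q (nonTrivial⇒n>1 q {{prime⇒nonTrivial q-prime}}) (z<s {n = e}))}}

  ∃-primitive-root : ∃ (_HasOrder (p ∸ 1))
  ∃-primitive-root = ∃-order-∣p∸1 (p ∸ 1) ∣-refl

  same-sum-product⇒≡[mod]⊎≡[mod] : ∀ x y k l → x + y ≡ k + l [mod p ] → x * y ≡ k * l [mod p ] →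
    x ≡ k [mod p ] ⊎ x ≡ l [mod p ]
  same-sum-product⇒≡[mod]⊎≡[mod] x y k l x+y≡k+l xy≡kl = Sum.map ∣∣-∣⇒≡[mod] ∣∣-∣⇒≡[mod]
    (euclidsLemma ∣ x - k ∣ ∣ x - l ∣ p-prime (subst (p ∣_) (sym (∣-∣*∣-∣≡∣-∣ x k l)) (≡[mod]⇒∣∣-∣ cross)))
    where
    cross : x * x + k * l ≡ x * k + x * l [mod p ]
    cross = begin
      x * x + k * l ≈⟨ +-congˡ-≡[mod] (x * x) xy≡kl ⟨
      x * x + x * y ≡⟨ *-distribˡ-+ x x y ⟨
      x * (x + y)   ≈⟨ *-congˡ-≡[mod] x x+y≡k+l ⟩
      x * (k + l)   ≡⟨ *-distribˡ-+ x k l ⟩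
      x * k + x * l ∎
      where open ≡[mod]-Reasoning p

-- The construction

module Construction {p m g θ : ℕ} (p-prime : Prime p) (m*g≡p∸1 : m * g ≡ p ∸ 1)
                    (θ-primitive : ModuloPrime._HasOrder_ p-prime θ (p ∸ 1)) where

  open ModuloPrime p-prime

  instance
    p∸1≢0 : NonZero (p ∸ 1)
    p∸1≢0 = >-nonZero 0<p∸1
    m≢0 : NonZero m
    m≢0 = m*n≢0⇒m≢0 m {{subst NonZero (sym m*g≡p∸1) p∸1≢0}}
    g≢0 : NonZero g
    g≢0 = m*n≢0⇒n≢0 m {{subst NonZero (sym m*g≡p∸1) p∸1≢0}}
    pm≢0 : NonZero (p * m)
    pm≢0 = m*n≢0 p m

  N : ℕ
  N = p * m

  y : ℕ → ℕ
  y i = m * θ ^ i + p * i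

  element : Fin (p ∸ 1) → Fin N
  element i = y (toℕ i) mod N

  A : Subset N
  A = ⋃ (map ⁅_⁆ (tabulate element))

  m∣p∸1 : m ∣ p ∸ 1
  m∣p∸1 = divides g (trans (sym m*g≡p∸1) (*-comm m g))

  p⊥m : Coprime p m
  p⊥m = ∤⇒coprime (>⇒∤ (≤-<-trans (subst (m ≤_) m*g≡p∸1 (m≤m*n m g)) (∸-monoʳ-< z<s (<⇒≤ 1<p))))

  split-≡[mod] : ∀ {u v s t} → m * u + p * s ≡ m * v + p * t [mod N ] → u ≡ v [mod p ] × s ≡ t [mod m ]
  split-≡[mod] {u} {v} {s} {t} eq = *-cancelˡ-≡[mod] p⊥m mod-p , *-cancelˡ-≡[mod] (Coprimality.sym p⊥m) mod-m
    where
    mod-p : m * u ≡ m * v [mod p ]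
    mod-p = begin
      m * u           ≈⟨ +-*-≡[mod] (m * u) s ⟨
      m * u + p * s   ≈⟨ ≡[mod]-weaken (m∣m*n m) eq ⟩
      m * v + p * t   ≈⟨ +-*-≡[mod] (m * v) t ⟩
      m * v           ∎
      where open ≡[mod]-Reasoning p
    mod-m : p * s ≡ p * t [mod m ]
    mod-m = begin
      p * s           ≈⟨ +-*-≡[mod] (p * s) u ⟨
      p * s + m * u   ≡⟨ +-comm (p * s) (m * u) ⟩
      m * u + p * s   ≈⟨ ≡[mod]-weaken (n∣m*n p) eq ⟩
      m * v + p * t   ≡⟨ +-comm (m * v) (p * t) ⟩
      p * t + m * v   ≈⟨ +-*-≡[mod] (p * t) v ⟩
      p * t           ∎
      where open ≡[mod]-Reasoning m

  θ-injective : ∀ {i j : Fin (p ∸ 1)} → θ ^ toℕ i ≡ θ ^ toℕ j [mod p ] → i ≡ j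
  θ-injective {i} {j} θⁱ≡θʲ = toℕ-injective (≡[mod]⇒≡ (toℕ<n i) (toℕ<n j) (hasOrder⇒^-injective θ-primitive θⁱ≡θʲ))

  element-injective : ∀ {i j} → element i ≡ element j → i ≡ j
  element-injective eq = θ-injective (proj₁ (split-≡[mod] (mod-injective eq)))

  ∣A∣≡p∸1 : ∣ A ∣ ≡ p ∸ 1
  ∣A∣≡p∸1 = trans (∣⋃⁅⁆∣≡length (Unique.tabulate⁺ element-injective)) (length-tabulate element)

  -- which of the g blocks of length m in ℤ_(p−1) contains i + j
  key : ℕ → ℕ → ℕ
  key i j = (i + j) % (p ∸ 1) / m

  key<g : ∀ i j → key i j < g
  key<g i j = m<n*o⇒m/o<n (subst ((i + j) % (p ∸ 1) <_) (trans (sym m*g≡p∸1) (*-comm m g)) (m%n<n (i + j) (p ∸ 1)))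

  y+y≡ : ∀ i j → y i + y j ≡ m * (θ ^ i + θ ^ j) + p * (i + j)
  y+y≡ i j = regroup m (θ ^ i) (θ ^ j) p i j
    where
    regroup : ∀ m a b p i j → m * a + p * i + (m * b + p * j) ≡ m * (a + b) + p * (i + j)
    regroup = solve-∀

  module _ {i j k l : Fin (p ∸ 1)} (sums≡ : y (toℕ i) + y (toℕ j) ≡ y (toℕ k) + y (toℕ l) [mod N ])
           (keys≡ : key (toℕ i) (toℕ j) ≡ key (toℕ k) (toℕ l)) where
    private
      i′ = toℕ i ; j′ = toℕ j ; k′ = toℕ k ; l′ = toℕ l

      components : θ ^ i′ + θ ^ j′ ≡ θ ^ k′ + θ ^ l′ [mod p ] × i′ + j′ ≡ k′ + l′ [mod m ]
      components = split-≡[mod] (begin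
        m * (θ ^ i′ + θ ^ j′) + p * (i′ + j′)  ≡⟨ y+y≡ i′ j′ ⟨
        y i′ + y j′                          ≈⟨ sums≡ ⟩
        y k′ + y l′                          ≡⟨ y+y≡ k′ l′ ⟩
        m * (θ ^ k′ + θ ^ l′) + p * (k′ + l′)  ∎)
        where open ≡[mod]-Reasoning N

      θ-sums≡ : θ ^ i′ + θ ^ j′ ≡ θ ^ k′ + θ ^ l′ [mod p ]
      θ-sums≡ = proj₁ components

      -- i + j and k + l agree modulo m and lie in the same block, hence agree modulo p − 1
      index-sums≡ : i′ + j′ ≡ k′ + l′ [mod p ∸ 1 ]
      index-sums≡ = mk≡[mod] (≡[mod]∧/≡⇒≡ (begin
        (i′ + j′) % (p ∸ 1)  ≈⟨ ≡[mod]-weaken m∣p∸1 (%-≡[mod] (i′ + j′)) ⟩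
        i′ + j′              ≈⟨ proj₂ components ⟩
        k′ + l′              ≈⟨ ≡[mod]-weaken m∣p∸1 (%-≡[mod] (k′ + l′)) ⟨
        (k′ + l′) % (p ∸ 1)  ∎) keys≡)
        where open ≡[mod]-Reasoning m

      θ-products≡ : θ ^ i′ * θ ^ j′ ≡ θ ^ k′ * θ ^ l′ [mod p ]
      θ-products≡ = begin
        θ ^ i′ * θ ^ j′    ≡⟨ ^-distribˡ-+-* θ i′ j′ ⟨
        θ ^ (i′ + j′)      ≈⟨ hasOrder⇒^≡^ θ-primitive index-sums≡ ⟩
        θ ^ (k′ + l′)      ≡⟨ ^-distribˡ-+-* θ k′ l′ ⟩
        θ ^ k′ * θ ^ l′    ∎
        where open ≡[mod]-Reasoning p

    same-sum-key⇒same-pair : (i ≡ k × j ≡ l) ⊎ (i ≡ l × j ≡ k)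
    same-sum-key⇒same-pair with same-sum-product⇒≡[mod]⊎≡[mod] (θ ^ i′) (θ ^ j′) (θ ^ k′) (θ ^ l′) θ-sums≡ θ-products≡
    ... | inj₁ θⁱ≡θᵏ = inj₁ (θ-injective θⁱ≡θᵏ , θ-injective (+-cancelˡ-≡[mod] (θ ^ i′) (begin
      θ ^ i′ + θ ^ j′  ≈⟨ θ-sums≡ ⟩
      θ ^ k′ + θ ^ l′  ≈⟨ +-cong-≡[mod] θⁱ≡θᵏ ≡[mod]-refl ⟨
      θ ^ i′ + θ ^ l′  ∎)))
      where open ≡[mod]-Reasoning p
    ... | inj₂ θⁱ≡θˡ = inj₂ (θ-injective θⁱ≡θˡ , θ-injective (+-cancelˡ-≡[mod] (θ ^ i′) (begin
      θ ^ i′ + θ ^ j′  ≈⟨ θ-sums≡ ⟩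
      θ ^ k′ + θ ^ l′  ≡⟨ +-comm (θ ^ k′) (θ ^ l′) ⟩
      θ ^ l′ + θ ^ k′  ≈⟨ +-cong-≡[mod] θⁱ≡θˡ ≡[mod]-refl ⟨
      θ ^ i′ + θ ^ k′  ∎)))
      where open ≡[mod]-Reasoning p

  ∈A⁻ : ∀ {a} → a ∈ₛ A → ∃ λ i → a ≡ element i
  ∈A⁻ a∈A = ∈-tabulate⁻ (∈-⋃⁅⁆⁻ (tabulate element) a∈A)

  module _ (b : Fin N) where

    repKey : ∀ {x} → IsRep A b x → Fin g
    repKey (_ , a₁∈A , a₂∈A , _) = fromℕ< (key<g (toℕ (proj₁ (∈A⁻ a₁∈A))) (toℕ (proj₁ (∈A⁻ a₂∈A))))

    repKey-injective : ∀ {x x′} (r : IsRep A b x) (r′ : IsRep A b x′) → repKey r ≡ repKey r′ → x ≡ x′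
    repKey-injective (a₁≤a₂ , a₁∈A , a₂∈A , a₁+a₂≡b) (c₁≤c₂ , c₁∈A , c₂∈A , c₁+c₂≡b) keys≡
      with ∈A⁻ a₁∈A | ∈A⁻ a₂∈A | ∈A⁻ c₁∈A | ∈A⁻ c₂∈A
    ... | i , refl | j , refl | k , refl | l , refl =
      ordered-pair-≡ a₁≤a₂ c₁≤c₂ (Sum.map congs congs
        (same-sum-key⇒same-pair (mod-+ₘ-injective (trans a₁+a₂≡b (sym c₁+c₂≡b)))
          (trans (sym (toℕ-fromℕ< _)) (trans (cong toℕ keys≡) (toℕ-fromℕ< _)))))
      where
      congs : ∀ {i j k l} → i ≡ k × j ≡ l → element i ≡ element k × element j ≡ element l
      congs = Product.map (cong element) (cong element)

  A∈B₂[g] : B2 N g A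
  A∈B₂[g] b = reps2≤ A b (repKey b) (repKey-injective b)

theorem3p1 : (g : ℕ) .{{_ : NonZero g}} (p : ℕ) → Prime p → p % g ≡ 1 % g →
    Σ (Subset ((p * p ∸ p) / g)) (λ A →
      (∣ A ∣ ≡ p ∸ 1) × B2 ((p * p ∸ p) / g) g A)
theorem3p1 g p p-prime p≡1[mod]g =
  subst (λ n → Σ (Subset n) (λ A → (∣ A ∣ ≡ p ∸ 1) × B2 n g A)) (sym (/g≡N)) (A , ∣A∣≡p∸1 , A∈B₂[g])
  where
  g∣p∸1 : g ∣ p ∸ 1
  g∣p∸1 = ≡[mod]⇒∣∸ (mk≡[mod] p≡1[mod]g)
  open Construction {m = (p ∸ 1) / g} {g} p-prime (m/n*n≡m g∣p∸1) (proj₂ (ModuloPrime.∃-primitive-root p-prime))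
  /g≡N : (p * p ∸ p) / g ≡ N
  /g≡N = trans (cong (_/ g) (trans (cong (p * p ∸_) (sym (*-identityʳ p))) (sym (*-distribˡ-∸ p p 1)))) (*-/-assoc p g∣p∸1)
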